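{- Even restricted to instances with $k_\#=1$, any deterministic algorithm for the MST problem under explorable uncertainty with predictions has competitive ratio $\rho\ge 2$.
   Context: An instance is a connected (multi)graph $G=(V,E)$; each edge $e$ has unknown true weight $w_e\in\mathbb{R}_+$ and known uncertainty interval $I_e$, either open $(L_e,U_e)\ni w_e$ or trivial $\{w_e\}$; predictions $\hat w_e\in I_e$ are given. Querying $e$ reveals $w_e$. $Q\subseteq E$ is a feasible query set if some spanning tree is an MST for every weight assignment equal to $w_e$ on $Q$ and arbitrary in $I_e$ outside $Q$; $\mathrm{OPT}$ is a minimum-cardinality feasible query set. An algorithm queries adaptively (adversarial true values) until its query set $\mathrm{ALG}$ is feasible; its competitive ratio on a class of instances is the smallest $\rho$ with $|\mathrm{ALG}|\le\rho|\mathrm{OPT}|$ on all of them. $k_\#=|\{e\in E: w_e\ne\hat w_e\}|$ is the number of wrong predictions.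
   Formalization: The true weights $w_e$, the interval endpoints, the predictions and the weight assignments quantified over in the definition of a feasible query set are taken in ℚ rather than ℝ. -}

module Defs where

open import Data.Nat using (ℕ; zero; suc)
open import Data.Integer using (+_)
open import Data.Rational using (ℚ; 0ℚ; _+_; _*_; _<_; _≤_; _/_)
open import Data.Rational.Properties using (_≟_)
open import Data.Fin using (Fin)
open import Data.Fin.Subset using (Subset; _∈_; _∉_; ⊥; ⁅_⁆; _∪_; ∣_∣)
open import Data.Vec using (lookup)
open import Data.Bool using (if_then_else_)
open import Data.List using (List; []; _∷_; foldr; filter; length; allFin)
open import Data.Maybe using (Maybe; just; nothing)
open import Data.Product using (Σ; _×_; _,_; proj₁)
open import Relation.Binary.PropositionalEquality using (_≡_; _≢_)
open import Relation.Nullary using (¬_)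
open import Relation.Nullary.Decidable using (¬?)

toℚ : ℕ → ℚ
toℚ k = (+ k) / 1

data Interval : Set where
  open⟨_,_⟩ : ℚ → ℚ → Interval
  point     : ℚ → Interval

_∈I_ : ℚ → Interval → Set
x ∈I open⟨ L , U ⟩ = (L < x) × (x < U)
x ∈I point y       = x ≡ y

-- intervals of nonnegative reals (here: rationals): 0 ≤ L < U, trivial values > 0
WellFormed : Interval → Set
WellFormed open⟨ L , U ⟩ = (0ℚ ≤ L) × (L < U)
WellFormed (point y)     = 0ℚ < y

-- Multigraphs with vertex set Fin n and edge set Fin m

Ends : ℕ → ℕ → Set
Ends n m = Fin m → Fin n × Fin n

data Reach {n m : ℕ} (ends : Ends n m) (P : Fin m → Set) : Fin n → Fin n → Set where
  here  : ∀ {u} → Reach ends P u u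
  fwd   : ∀ {u v} (e : Fin m) → P e → ends e ≡ (u , v) →
          ∀ {z} → Reach ends P v z → Reach ends P u z
  bwd   : ∀ {u v} (e : Fin m) → P e → ends e ≡ (v , u) →
          ∀ {z} → Reach ends P v z → Reach ends P u z

ConnectedVia : {n m : ℕ} → Ends n m → (Fin m → Set) → Set
ConnectedVia ends P = ∀ u v → Reach ends P u v

Connected : {n m : ℕ} → Ends n m → Set
Connected {m = m} ends = ConnectedVia ends (λ _ → Fin m)

-- spanning tree = minimally connected spanning subgraph
SpanningTree : {n m : ℕ} → Ends n m → Subset m → Set
SpanningTree ends T =
  ConnectedVia ends (λ f → f ∈ T) ×
  (∀ e → e ∈ T → ¬ Reach ends (λ f → (f ∈ T) × (f ≢ e)) (proj₁ (ends e)) (Data.Product.proj₂ (ends e)))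

weight : {m : ℕ} → (Fin m → ℚ) → Subset m → ℚ
weight {m} w T = foldr (λ e acc → (if lookup T e then w e else 0ℚ) + acc) 0ℚ (allFin m)

IsMST : {n m : ℕ} → Ends n m → (Fin m → ℚ) → Subset m → Set
IsMST ends w T = SpanningTree ends T × (∀ T' → SpanningTree ends T' → weight w T ≤ weight w T')

Feasible : {n m : ℕ} → Ends n m → (Fin m → Interval) → (Fin m → ℚ) → Subset m → Set
Feasible {m = m} ends I w Q =
  Σ (Subset m) λ T → ∀ (w' : Fin m → ℚ) →
    (∀ e → e ∈ Q → w' e ≡ w e) → (∀ e → e ∉ Q → w' e ∈I I e) → IsMST ends w' T

IsOPT : {n m : ℕ} → Ends n m → (Fin m → Interval) → (Fin m → ℚ) → Subset m → Set
IsOPT {m = m} ends I w O =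
  Feasible ends I w O × (∀ Q → Feasible ends I w Q → ∣ O ∣ Data.Nat.≤ ∣ Q ∣)

record Instance : Set where
  field
    n m       : ℕ
    ends      : Ends n m
    interval  : Fin m → Interval
    pred      : Fin m → ℚ
    w         : Fin m → ℚ      -- true (hidden) weights
    connected : Connected ends
    wf        : ∀ e → WellFormed (interval e)
    w∈        : ∀ e → w e ∈I interval e
    pred∈     : ∀ e → pred e ∈I interval e

kHash : Instance → ℕ
kHash G = length (filter (λ e → ¬? (w e ≟ pred e)) (allFin m))
  where open Instance G

-- Input: the visible instance data (graph, intervals, predictions) and the
-- history of queries so far (edge, revealed true weight), most recent first.
-- Output: the next edge to query, or nothing (stop).

Algorithm : Set
Algorithm = ∀ {n m} → Ends n m → (Fin m → Interval) → (Fin m → ℚ) →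
            List (Fin m × ℚ) → Maybe (Fin m)

history : Algorithm → (G : Instance) → ℕ → List (Fin (Instance.m G) × ℚ)
history A G zero = []
history A G (suc t) with A ends interval pred (history A G t)
  where open Instance G
... | nothing = history A G t
... | just e  = (e , Instance.w G e) ∷ history A G t

querySet : {m : ℕ} → List (Fin m × ℚ) → Subset m
querySet = foldr (λ q S → ⁅ proj₁ q ⁆ ∪ S) ⊥

QueriesAt : Algorithm → (G : Instance) → ℕ → Subset (Instance.m G)
QueriesAt A G t = querySet (history A G t)

-- Take two parallel edges with intervals (0,2) and (1,3) and both predictions 3/2.
-- Whichever edge e the algorithm queries first, the adversary makes e's prediction
-- correct and the other edge's prediction wrong, far enough outside the overlap (1,2)
-- that querying the other edge alone certifies an MST.  Knowing e's weight 3/2 decides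
-- nothing, since the other interval still contains values on both sides of 3/2; so the
-- algorithm needs both edges while OPT needs one.
module Submission where

open import Defs
open import Data.Product using (Σ; ∃; _×_; _,_; proj₁; proj₂)
open import Data.Rational using (ℚ; _<_; _≤_; _*_; _/_; 0ℚ)
open import Data.Integer using (+_)
open import Data.Nat using (ℕ; zero; suc)
open import Data.Fin using (Fin; zero; suc)
open import Data.Fin.Subset using (Subset; ∣_∣; _∈_; _∉_; _⊆_; ⁅_⁆; ⊥)
open import Data.Fin.Subset.Properties
  using (x∈⁅x⁆; x∈⁅y⁆⇒x≡y; ∉⊥; p⊆p∪q; q⊆p∪q; _∈?_; p⊆q⇒∣p∣≤∣q∣; ∣⁅x⁆∣≡1)
open import Data.Vec using (_∷_; []; here; there)
open import Data.Bool using (true; false)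
open import Data.List using ([])
open import Data.Maybe using (Maybe; just; nothing)
open import Data.Sum using (_⊎_; inj₁; inj₂)
open import Data.Empty using (⊥-elim)
open import Relation.Binary.PropositionalEquality
  using (_≡_; _≢_; refl; sym; trans; subst; subst₂)
open import Relation.Nullary using (¬_; yes; no)
open import Relation.Nullary.Decidable using (True; toWitness)
import Data.Rational.Properties as ℚ

private
  variable
    n m : ℕ

firstQuery : Algorithm → (G : Instance) → Maybe (Fin (Instance.m G))
firstQuery A G = A ends interval pred []
  where open Instance G

first-query-stays-queried : ∀ (A : Algorithm) G {f} → firstQuery A G ≡ just f →
                            ∀ t → f ∈ QueriesAt A G (suc t)
first-query-stays-queried A G {f} first zero rewrite first = p⊆p∪q ⊥ (x∈⁅x⁆ f)
first-query-stays-queried A G first (suc t)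
  with A (Instance.ends G) (Instance.interval G) (Instance.pred G) (history A G (suc t))
... | nothing = first-query-stays-queried A G first t
... | just e  = q⊆p∪q ⁅ e ⁆ _ (first-query-stays-queried A G first t)

queried⇒first-query-queried : ∀ (A : Algorithm) G {e f} t → firstQuery A G ≡ just f →
                              e ∈ QueriesAt A G t → f ∈ QueriesAt A G t
queried⇒first-query-queried A G zero    first e∈⊥ = ⊥-elim (∉⊥ e∈⊥)
queried⇒first-query-queried A G (suc t) first _   = first-query-stays-queried A G first t

idle-history : ∀ (A : Algorithm) G → firstQuery A G ≡ nothing → ∀ t → history A G t ≡ []
idle-history A G idle zero = refl
idle-history A G idle (suc t) rewrite idle-history A G idle t | idle = idle-history A G idle t

idle⇒nothing-queried : ∀ (A : Algorithm) G {e} t → firstQuery A G ≡ nothing → e ∉ QueriesAt A G t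
idle⇒nothing-queried A G t idle e∈ =
  ∉⊥ (subst (λ h → _ ∈ querySet h) (idle-history A G idle t) e∈)

Consistent : (Fin m → Interval) → (Fin m → ℚ) → Subset m → (Fin m → ℚ) → Set
Consistent I w Q w' = (∀ e → e ∈ Q → w' e ≡ w e) × (∀ e → e ∉ Q → w' e ∈I I e)

feasible⇒mst : ∀ {ends : Ends n m} {I w Q} → (F : Feasible ends I w Q) →
               ∀ {w'} → Consistent I w Q w' → IsMST ends w' (proj₁ F)
feasible⇒mst (_ , mst) (agree , inside) = mst _ agree inside

singleton-opt : ∀ {ends : Ends n m} {I w e} → Feasible ends I w ⁅ e ⁆ →
                (∀ Q → Feasible ends I w Q → e ∈ Q) → IsOPT ends I w ⁅ e ⁆
singleton-opt {e = e} feasible needed = feasible , λ Q F → p⊆q⇒∣p∣≤∣q∣ (⁅⁆⊆ (needed Q F))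
  where
  ⁅⁆⊆ : ∀ {Q} → e ∈ Q → ⁅ e ⁆ ⊆ Q
  ⁅⁆⊆ {Q} e∈Q x∈⁅e⁆ = subst (_∈ Q) (sym (x∈⁅y⁆⇒x≡y e x∈⁅e⁆)) e∈Q

reach-distinct⇒edge : ∀ {ends : Ends n m} {P u v} → Reach ends P u v → u ≢ v → ∃ P
reach-distinct⇒edge here          u≢u = ⊥-elim (u≢u refl)
reach-distinct⇒edge (fwd e p _ _) _   = e , p
reach-distinct⇒edge (bwd e p _ _) _   = e , p

digon : Ends 2 2
digon _ = zero , suc zero

other : Fin 2 → Fin 2
other zero       = suc zero
other (suc zero) = zero

other-involutive : ∀ e → other (other e) ≡ e
other-involutive zero       = refl
other-involutive (suc zero) = refl

other-≢ : ∀ e → other e ≢ e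
other-≢ zero       ()
other-≢ (suc zero) ()

≡-or-other : ∀ e f → f ≡ e ⊎ f ≡ other e
≡-or-other zero       zero       = inj₁ refl
≡-or-other zero       (suc zero) = inj₂ refl
≡-or-other (suc zero) zero       = inj₂ refl
≡-or-other (suc zero) (suc zero) = inj₁ refl

digon-connected : ∀ {P} e → P e → ConnectedVia digon P
digon-connected e p zero       zero       = here
digon-connected e p zero       (suc zero) = fwd e p refl here
digon-connected e p (suc zero) zero       = bwd e p refl here
digon-connected e p (suc zero) (suc zero) = here

singleton-spanning-tree : ∀ e → SpanningTree digon ⁅ e ⁆
singleton-spanning-tree e = digon-connected e (x∈⁅x⁆ e) , acyclic
  where
  acyclic : ∀ f → f ∈ ⁅ e ⁆ →
            ¬ Reach digon (λ g → (g ∈ ⁅ e ⁆) × (g ≢ f)) zero (suc zero)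
  acyclic f f∈ path with reach-distinct⇒edge path (λ ())
  ... | g , g∈ , g≢f = g≢f (trans (x∈⁅y⁆⇒x≡y e g∈) (sym (x∈⁅y⁆⇒x≡y e f∈)))

spanning-tree⇒singleton : ∀ {T} → SpanningTree digon T → ∃ λ e → T ≡ ⁅ e ⁆
spanning-tree⇒singleton {false ∷ false ∷ []} (connected , _)
  with reach-distinct⇒edge (connected zero (suc zero)) (λ ())
... | zero     , ()
... | suc zero , there ()
spanning-tree⇒singleton {true  ∷ false ∷ []} _ = zero , refl
spanning-tree⇒singleton {false ∷ true  ∷ []} _ = suc zero , refl
spanning-tree⇒singleton {true  ∷ true  ∷ []} (_ , acyclic) =
  ⊥-elim (acyclic zero here (fwd (suc zero) (there here , λ ()) refl here))

weight-singleton : ∀ (w : Fin 2 → ℚ) e → weight w ⁅ e ⁆ ≡ w e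
weight-singleton w zero       = ℚ.+-identityʳ (w zero)
weight-singleton w (suc zero) = trans (ℚ.+-identityˡ _) (ℚ.+-identityʳ (w (suc zero)))

singleton-mst : ∀ (w : Fin 2 → ℚ) e → w e ≤ w (other e) → IsMST digon w ⁅ e ⁆
singleton-mst w e e≤other = singleton-spanning-tree e , minimal
  where
  minimal : ∀ T → SpanningTree digon T → weight w ⁅ e ⁆ ≤ weight w T
  minimal T tree with spanning-tree⇒singleton tree
  ... | f , refl with ≡-or-other e f
  ...   | inj₁ refl = ℚ.≤-refl
  ...   | inj₂ refl = subst₂ _≤_ (sym (weight-singleton w e))
                                 (sym (weight-singleton w (other e))) e≤other

mst-lighter-edge : ∀ (w : Fin 2 → ℚ) e {T} → IsMST digon w T → w e < w (other e) → T ≡ ⁅ e ⁆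
mst-lighter-edge w e (tree , minimal) e<other with spanning-tree⇒singleton tree
... | f , refl with ≡-or-other e f
...   | inj₁ refl = refl
...   | inj₂ refl = ⊥-elim (ℚ.<-irrefl refl (ℚ.<-≤-trans e<other other≤e))
  where
  other≤e : w (other e) ≤ w e
  other≤e = subst₂ _≤_ (weight-singleton w (other e)) (weight-singleton w e)
                       (minimal ⁅ e ⁆ (singleton-spanning-tree e))

mst-heavier-edge : ∀ (w : Fin 2 → ℚ) e {T} → IsMST digon w T → w (other e) < w e → T ≡ ⁅ other e ⁆
mst-heavier-edge w e mst other<e =
  mst-lighter-edge w (other e) mst (subst (λ f → w (other e) < w f) (sym (other-involutive e)) other<e)

assign : Fin 2 → ℚ → ℚ → Fin 2 → ℚ
assign zero       a c zero       = a
assign zero       a c (suc zero) = c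
assign (suc zero) a c zero       = c
assign (suc zero) a c (suc zero) = a

assign-at : ∀ e a c → assign e a c e ≡ a
assign-at zero       a c = refl
assign-at (suc zero) a c = refl

assign-other : ∀ e a c → assign e a c (other e) ≡ c
assign-other zero       a c = refl
assign-other (suc zero) a c = refl

assign-consistent : ∀ {I w Q} e {x} → e ∉ Q → w (other e) ∈I I (other e) → x ∈I I e →
                    Consistent I w Q (assign e x (w (other e)))
assign-consistent {I} {w} {Q} e {x} e∉Q c∈ x∈ = agree , inside
  where
  agree : ∀ f → f ∈ Q → assign e x (w (other e)) f ≡ w f
  agree f f∈Q with ≡-or-other e f
  ... | inj₁ refl = ⊥-elim (e∉Q f∈Q)
  ... | inj₂ refl = assign-other e x (w (other e))
  inside : ∀ f → f ∉ Q → assign e x (w (other e)) f ∈I I f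
  inside f _ with ≡-or-other e f
  ... | inj₁ refl = subst (_∈I I e) (sym (assign-at e x (w (other e)))) x∈
  ... | inj₂ refl = subst (_∈I I (other e)) (sym (assign-other e x (w (other e)))) c∈

-- While e is unqueried, its weight may fall on either side of the other edge's,
-- and no single tree is an MST in both cases.
straddling-edge-queried : ∀ {I w Q} e {a b} → w (other e) ∈I I (other e) →
                          a ∈I I e → b ∈I I e → a < w (other e) → w (other e) < b →
                          Feasible digon I w Q → e ∈ Q
straddling-edge-queried {I} {w} {Q} e {a} {b} c∈ a∈ b∈ a<c c<b F with e ∈? Q
... | yes e∈Q = e∈Q
... | no  e∉Q = ⊥-elim (other-≢ e (x∈⁅y⁆⇒x≡y e
                  (subst (other e ∈_) (trans (sym tree≡other) tree≡e) (x∈⁅x⁆ (other e)))))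
  where
  c = w (other e)
  tree≡e : proj₁ F ≡ ⁅ e ⁆
  tree≡e = mst-lighter-edge (assign e a c) e
             (feasible⇒mst F (assign-consistent e e∉Q c∈ a∈))
             (subst₂ _<_ (sym (assign-at e a c)) (sym (assign-other e a c)) a<c)
  tree≡other : proj₁ F ≡ ⁅ other e ⁆
  tree≡other = mst-heavier-edge (assign e b c) e
                 (feasible⇒mst F (assign-consistent e e∉Q c∈ b∈))
                 (subst₂ _<_ (sym (assign-other e b c)) (sym (assign-at e b c)) c<b)

both-edges-queried : ∀ e {Q : Subset 2} → e ∈ Q → other e ∈ Q → ∣ Q ∣ ≡ 2
both-edges-queried zero       {_ ∷ _ ∷ []} here         (there here) = refl
both-edges-queried (suc zero) {_ ∷ _ ∷ []} (there here) here         = refl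

decide : ∀ p q → {True (p ℚ.<? q)} → p < q
decide p q {p<q} = toWitness p<q

intervals : Fin 2 → Interval
intervals zero       = open⟨ 0ℚ , (+ 2) / 1 ⟩
intervals (suc zero) = open⟨ (+ 1) / 1 , (+ 3) / 1 ⟩

prediction : Fin 2 → ℚ
prediction _ = (+ 3) / 2

-- The answer to an algorithm whose first query is e: e keeps its predicted weight 3/2.
adversaryWeight : Fin 2 → Fin 2 → ℚ
adversaryWeight zero       = assign zero       ((+ 3) / 2) ((+ 5) / 2)
adversaryWeight (suc zero) = assign (suc zero) ((+ 3) / 2) ((+ 1) / 2)

adversary : Fin 2 → Instance
adversary e = record
  { n = 2 ; m = 2 ; ends = digon ; interval = intervals ; pred = prediction
  ; w = adversaryWeight e ; connected = digon-connected zero zero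
  ; wf = wf ; w∈ = w∈ e ; pred∈ = pred∈ }
  where
  wf : ∀ f → WellFormed (intervals f)
  wf zero       = ℚ.≤-refl , decide _ _
  wf (suc zero) = ℚ.<⇒≤ (decide _ _) , decide _ _
  w∈ : ∀ e f → adversaryWeight e f ∈I intervals f
  w∈ zero       zero       = decide _ _ , decide _ _
  w∈ zero       (suc zero) = decide _ _ , decide _ _
  w∈ (suc zero) zero       = decide _ _ , decide _ _
  w∈ (suc zero) (suc zero) = decide _ _ , decide _ _
  pred∈ : ∀ f → prediction f ∈I intervals f
  pred∈ zero       = decide _ _ , decide _ _
  pred∈ (suc zero) = decide _ _ , decide _ _

adversary-kHash : ∀ e → kHash (adversary e) ≡ 1
adversary-kHash zero       = refl
adversary-kHash (suc zero) = refl

adversary-needs-other : ∀ e {Q} → Feasible digon intervals (adversaryWeight e) Q → other e ∈ Q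
adversary-needs-other zero =
  straddling-edge-queried (suc zero) {(+ 5) / 4} {(+ 7) / 4}
    (decide _ _ , decide _ _) (decide _ _ , decide _ _) (decide _ _ , decide _ _) (decide _ _) (decide _ _)
adversary-needs-other (suc zero) =
  straddling-edge-queried zero {(+ 5) / 4} {(+ 7) / 4}
    (decide _ _ , decide _ _) (decide _ _ , decide _ _) (decide _ _ , decide _ _) (decide _ _) (decide _ _)

-- Revealing the wrongly predicted edge separates the two intervals.
adversary-feasible : ∀ e → Feasible digon intervals (adversaryWeight e) ⁅ other e ⁆
adversary-feasible zero = ⁅ zero ⁆ , λ w' agree inside →
  singleton-mst w' zero (ℚ.<⇒≤ (ℚ.<-trans (proj₂ (inside zero (λ ())))
    (subst ((+ 2) / 1 <_) (sym (agree (suc zero) (x∈⁅x⁆ (suc zero)))) (decide _ _))))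
adversary-feasible (suc zero) = ⁅ zero ⁆ , λ w' agree inside →
  singleton-mst w' zero (ℚ.<⇒≤ (ℚ.<-trans
    (subst (_< (+ 1) / 1) (sym (agree zero (x∈⁅x⁆ zero))) (decide _ _))
    (proj₁ (inside (suc zero) (λ { (there ()) })))))

adversary-opt : ∀ e → IsOPT digon intervals (adversaryWeight e) ⁅ other e ⁆
adversary-opt e = singleton-opt (adversary-feasible e) (λ _ → adversary-needs-other e)

ratio-below-two : ∀ {ρ : ℚ} (O Q : Subset n) → ρ < (+ 2) / 1 →
                  ∣ O ∣ ≡ 1 → ∣ Q ∣ ≡ 2 → ρ * toℚ ∣ O ∣ < toℚ ∣ Q ∣
ratio-below-two {ρ = ρ} O Q ρ<2 ∣O∣≡1 ∣Q∣≡2 rewrite ∣O∣≡1 | ∣Q∣≡2 | ℚ.*-identityʳ ρ = ρ<2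

lemmaA1 : (A : Algorithm) (ρ : ℚ) → ρ < (+ 2) / 1 →
          Σ Instance λ G → (kHash G ≡ 1) ×
            Σ (Subset (Instance.m G)) λ O →
              IsOPT (Instance.ends G) (Instance.interval G) (Instance.w G) O ×
              ((t : ℕ) →
                Feasible (Instance.ends G) (Instance.interval G) (Instance.w G) (QueriesAt A G t) →
                ρ * toℚ ∣ O ∣ < toℚ ∣ QueriesAt A G t ∣)
lemmaA1 A ρ ρ<2 with A digon intervals prediction [] in first
... | just e  = adversary e , adversary-kHash e , ⁅ other e ⁆ , adversary-opt e , beaten
  where
  beaten : ∀ t → Feasible digon intervals (adversaryWeight e) (QueriesAt A (adversary e) t) →
           ρ * toℚ ∣ ⁅ other e ⁆ ∣ < toℚ ∣ QueriesAt A (adversary e) t ∣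
  beaten t F = ratio-below-two ⁅ other e ⁆ (QueriesAt A (adversary e) t) ρ<2 (∣⁅x⁆∣≡1 (other e))
                 (both-edges-queried e (queried⇒first-query-queried A (adversary e) t first other∈) other∈)
    where other∈ = adversary-needs-other e F
... | nothing = adversary zero , adversary-kHash zero , ⁅ suc zero ⁆ , adversary-opt zero ,
                λ t F → ⊥-elim (idle⇒nothing-queried A (adversary zero) t first (adversary-needs-other zero F))
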